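{- Let $\mathcal H$ be a Berge-$C_4$-free hypergraph on a vertex set $V$ (multiple copies of a hyperedge allowed). Suppose that for each hyperedge $h\in\mathcal H$ we are given a set $E_h$ of $\max(|h|-3,0)$ pairs of vertices of $h$ such that the edges of $E_h$ form a collection of pairwise vertex-disjoint triangles and single edges, and that the sets $E_h$ ($h\in\mathcal H$) are pairwise disjoint. Let $H$ be the graph on $V$ with edge set $\bigcup_{h}E_h$, and say that an edge $e\in E_h$ has color $h$. For a vertex $v$ let $N_1(v)=\{x: vx\in E(H)\}$, $d(v)=|N_1(v)|$, and $N_2(v)=\{y\notin N_1(v)\cup\{v\}: \exists x\in N_1(v),\ xy\in E(H)\}$. Let $G=H[N_1(v)]$ be the subgraph of $H$ induced by $N_1(v)$, let $G_{aux}$ be the graph on vertex set $N_1(v)$ in which $xy$ is an edge if and only if there exists $w\in N_2(v)$ with $wx,wy\in E(H)$, and let $G'_{aux}$ be the graph on $N_1(v)$ with edge set $E(G_{aux})\setminus E(G)$. If $d(v)\ge 1$, then $|E(G'_{aux})|<d(v)^{9/5}$.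
   Context: A Berge cycle of length $4$ in a hypergraph is an alternating sequence $v_1,h_1,v_2,h_2,v_3,h_3,v_4,h_4$ of distinct vertices and distinct hyperedges with $v_i,v_{i+1}\in h_i$ for $i=1,2,3$ and $v_4,v_1\in h_4$; Berge-$C_4$-free means no such sequence exists. -}

module Defs where

open import Data.Nat using (ℕ; zero; suc; _+_; _∸_; _<ᵇ_)
open import Data.Bool using (Bool; true; false; if_then_else_; _∧_; _∨_; not)
open import Data.Fin using (Fin; toℕ)
open import Data.Fin.Subset using (Subset; _∈_; ∣_∣)
open import Data.List using (List; []; _∷_; map; allFin)
open import Data.Nat.ListAction using (sum)
open import Data.Bool.ListAction using (any)
open import Data.List.Membership.Propositional renaming (_∈_ to _∈ₗ_)
open import Data.List.Relation.Unary.AllPairs using (AllPairs)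
open import Data.Vec using (tabulate)
open import Data.Product using (Σ; _×_; ∃; ∃-syntax)
open import Data.Empty using (⊥)
open import Relation.Nullary using (¬_)
open import Relation.Binary.PropositionalEquality using (_≡_; _≢_)
open import Function.Bundles using (_⇔_)

-- Hypergraphs on the finite vertex set V = Fin n, with m hyperedges
-- indexed by Fin m (so repeated copies of a hyperedge are allowed).

Hypergraph : ℕ → ℕ → Set
Hypergraph n m = Fin m → Subset n

BergeC4 : ∀ {n m} → Hypergraph n m → Set
BergeC4 {n} {m} 𝓗 =
  Σ (Fin n) λ v₁ → Σ (Fin n) λ v₂ → Σ (Fin n) λ v₃ → Σ (Fin n) λ v₄ →
  Σ (Fin m) λ h₁ → Σ (Fin m) λ h₂ → Σ (Fin m) λ h₃ → Σ (Fin m) λ h₄ →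
    (v₁ ≢ v₂ × v₁ ≢ v₃ × v₁ ≢ v₄ × v₂ ≢ v₃ × v₂ ≢ v₄ × v₃ ≢ v₄)
  × (h₁ ≢ h₂ × h₁ ≢ h₃ × h₁ ≢ h₄ × h₂ ≢ h₃ × h₂ ≢ h₄ × h₃ ≢ h₄)
  × (v₁ ∈ 𝓗 h₁ × v₂ ∈ 𝓗 h₁)
  × (v₂ ∈ 𝓗 h₂ × v₃ ∈ 𝓗 h₂)
  × (v₃ ∈ 𝓗 h₃ × v₄ ∈ 𝓗 h₃)
  × (v₄ ∈ 𝓗 h₄ × v₁ ∈ 𝓗 h₄)

BergeC4Free : ∀ {n m} → Hypergraph n m → Set
BergeC4Free 𝓗 = ¬ BergeC4 𝓗

-- Simple graphs on Fin n given by a Boolean adjacency relation.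
-- (An edge set of unordered pairs is a symmetric irreflexive relation.)

Adj : ℕ → Set
Adj n = Fin n → Fin n → Bool

IsSimple : ∀ {n} → Adj n → Set
IsSimple {n} A = (∀ x y → A x y ≡ A y x) × (∀ x → A x x ≡ false)

edgeCount : ∀ {n} → Adj n → ℕ
edgeCount {n} A =
  sum (map (λ x → sum (map (λ y → if (toℕ x <ᵇ toℕ y) ∧ A x y then 1 else 0)
                             (allFin n)))
           (allFin n))

data Comp (n : ℕ) : Set where
  edgeC : Fin n → Fin n → Comp n
  triC  : Fin n → Fin n → Fin n → Comp n

verts : ∀ {n} → Comp n → List (Fin n)
verts (edgeC x y)  = x ∷ y ∷ []
verts (triC x y z) = x ∷ y ∷ z ∷ []

WellFormedComp : ∀ {n} → Comp n → Set
WellFormedComp (edgeC x y)  = x ≢ y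
WellFormedComp (triC x y z) = x ≢ y × x ≢ z × y ≢ z

VertexDisjoint : ∀ {n} → Comp n → Comp n → Set
VertexDisjoint c c' = ∀ v → v ∈ₗ verts c → v ∈ₗ verts c' → ⊥

DisjointTrianglesAndEdges : ∀ {n} → Adj n → Set
DisjointTrianglesAndEdges {n} A =
  Σ (List (Comp n)) λ cs →
      (∀ c → c ∈ₗ cs → WellFormedComp c)
    × AllPairs VertexDisjoint cs
    × (∀ x y → (A x y ≡ true) ⇔
         (Σ (Comp n) λ c → c ∈ₗ cs × x ∈ₗ verts c × y ∈ₗ verts c × x ≢ y))

ValidColouring : ∀ {n m} → Hypergraph n m → (Fin m → Adj n) → Set
ValidColouring {n} {m} 𝓗 E =
    (∀ i → IsSimple (E i))
  × (∀ i x y → E i x y ≡ true → x ∈ 𝓗 i × y ∈ 𝓗 i)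
  × (∀ i → edgeCount (E i) ≡ ∣ 𝓗 i ∣ ∸ 3)
  × (∀ i → DisjointTrianglesAndEdges (E i))
  × (∀ i j x y → i ≢ j → E i x y ≡ true → E j x y ≡ false)

module _ {n m : ℕ} (E : Fin m → Adj n) where

  HAdj : Adj n
  HAdj x y = any (λ i → E i x y) (allFin m)

  existsV : (Fin n → Bool) → Bool
  existsV P = any P (allFin n)

  eqᵇ : Fin n → Fin n → Bool
  eqᵇ x y = Data.Nat._≡ᵇ_ (toℕ x) (toℕ y)

  inN₁ : Fin n → Fin n → Bool
  inN₁ v x = HAdj v x

  N₁ : Fin n → Subset n
  N₁ v = tabulate (inN₁ v)

  deg : Fin n → ℕ
  deg v = ∣ N₁ v ∣

  inN₂ : Fin n → Fin n → Bool
  inN₂ v y = not (inN₁ v y) ∧ not (eqᵇ y v) ∧ existsV (λ x → inN₁ v x ∧ HAdj x y)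

  Gv : Fin n → Adj n
  Gv v x y = inN₁ v x ∧ inN₁ v y ∧ HAdj x y

  Gaux : Fin n → Adj n
  Gaux v x y = inN₁ v x ∧ inN₁ v y ∧ not (eqᵇ x y)
               ∧ existsV (λ w → inN₂ v w ∧ HAdj w x ∧ HAdj w y)

  Gaux' : Fin n → Adj n
  Gaux' v x y = Gaux v x y ∧ not (Gv v x y)

module Submission where

-- Say that a neighbour x of v points to a neighbour y of v (x → y) if y lies
-- in the hyperedge i of the colour of vx while vy does not have colour i.
-- Let P be the number of pointers and indeg(y) the number of x with x → y.
--  (1) Every edge xy of G'_aux yields x → y or y → x: otherwise, with w the
--      common neighbour of x and y in N₂(v), the cycle v x w y has four
--      distinct colours, a Berge C₄.  Hence e ≤ P; trivially also 2e ≤ d².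
--  (2) If vx and vx' have different colours, x and x' have at most two
--      common targets (three would close a Berge C₄ or give v three edges of
--      one colour); vx shares its colour with at most two vx'.  Counting the
--      triples x → y ← x' gives Σ indeg(y)² ≤ 2d² + 2P.
--  (3) By Cauchy–Schwarz over the d neighbours of v, P² ≤ d Σ indeg(y)².
-- So P² ≤ d(2d² + 2P), and elementary arithmetic yields e⁵ < d⁹.

open import Defs
open import Data.Nat using (ℕ; zero; suc; _+_; _*_; _^_; _≤_; _<_; _<ᵇ_; z≤n; s≤s; _≤?_; _<?_; >-nonZero)
open import Data.Nat.Properties hiding (_≟_)
open import Data.Nat.Tactic.RingSolver using (solve-∀)
open import Data.Nat.ListAction using () renaming (sum to sumₗ)
open import Data.Bool using (Bool; true; false; _∧_; not; if_then_else_; T)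
open import Data.Bool.ListAction using (any)
open import Data.Bool.Properties using (T-≡)
open import Data.Fin using (Fin; zero; suc; toℕ; _≟_)
import Data.Fin.Properties as Fin
open import Data.Fin.Subset using (_∈_; ∣_∣)
open import Data.List using (List; []; _∷_; length; map; allFin; tabulate)
open import Data.List.Properties using (map-tabulate; length-removeAt′)
open import Data.List.Relation.Unary.Any using (here; there; index; satisfied)
open import Data.List.Relation.Unary.Any.Properties using (any⁺; any⁻)
open import Data.List.Relation.Unary.All as All using (All)
open import Data.List.Relation.Unary.AllPairs using (AllPairs; []; _∷_)
open import Data.List.Membership.Propositional using (lose; _─_) renaming (_∈_ to _∈ₗ_)
open import Data.List.Membership.Propositional.Properties using (∈-allFin)
import Data.Vec as Vec
open import Data.Vec.Properties using ([]=⇒lookup; lookup⇒[]=)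
open import Data.Product using (Σ; _×_; _,_; proj₁; proj₂; swap)
open import Data.Sum using (_⊎_; inj₁; inj₂)
open import Data.Empty using (⊥; ⊥-elim)
open import Function using (_∘_)
open import Function.Bundles using (Equivalence)
open import Relation.Nullary using (yes; no)
open import Relation.Binary.PropositionalEquality

open import Algebra.Properties.Semiring.Sum +-*-semiring
  using (sum; sum-syntax; sum-cong-≗; ∑-distrib-+; ∑-comm; *-distribˡ-sum; *-distribʳ-sum)

⟦_⟧ : Bool → ℕ
⟦ true ⟧  = 1
⟦ false ⟧ = 0

⟦∧⟧ : ∀ a b → ⟦ a ∧ b ⟧ ≡ ⟦ a ⟧ * ⟦ b ⟧
⟦∧⟧ true  b = sym (*-identityˡ ⟦ b ⟧)
⟦∧⟧ false b = refl

∧-true : ∀ {a b} → a ∧ b ≡ true → a ≡ true × b ≡ true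
∧-true {true} b≡true = refl , b≡true

∧-intro : ∀ {a b} → a ≡ true → b ≡ true → a ∧ b ≡ true
∧-intro refl b≡true = b≡true

not-true : ∀ {b} → not b ≡ true → b ≡ false
not-true {false} refl = refl

not-intro : ∀ {b} → b ≡ false → not b ≡ true
not-intro refl = refl

true≢false : ∀ {b} → b ≡ true → b ≡ false → ⊥
true≢false refl ()

⟦⟧-mono : ∀ {a b} → (a ≡ true → b ≡ true) → ⟦ a ⟧ ≤ ⟦ b ⟧
⟦⟧-mono {false} a⇒b = z≤n
⟦⟧-mono {true}  a⇒b rewrite a⇒b refl = ≤-refl

⟦⟧-split : ∀ {a b c} → (a ≡ true → b ≡ true ⊎ c ≡ true) → ⟦ a ⟧ ≤ ⟦ b ⟧ + ⟦ c ⟧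
⟦⟧-split {false} a⇒b∨c = z≤n
⟦⟧-split {true}  a⇒b∨c with a⇒b∨c refl
... | inj₁ refl = s≤s z≤n
... | inj₂ refl = m≤n+m 1 _

count : ∀ {n} → (Fin n → Bool) → ℕ
count {n} p = ∑[ i < n ] ⟦ p i ⟧

∑-mono : ∀ {n} {f g : Fin n → ℕ} → (∀ i → f i ≤ g i) → sum f ≤ sum g
∑-mono {zero}  f≤g = z≤n
∑-mono {suc n} f≤g = +-mono-≤ (f≤g zero) (∑-mono (f≤g ∘ suc))

count-mono : ∀ {n} {p q : Fin n → Bool} → (∀ i → p i ≡ true → q i ≡ true) → count p ≤ count q
count-mono p⇒q = ∑-mono (λ i → ⟦⟧-mono (p⇒q i))

count-none : ∀ {n} (p : Fin n → Bool) → (∀ a → p a ≢ true) → count p ≡ 0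
count-none {zero}  p none = refl
count-none {suc n} p none with p zero in eq
... | true  = ⊥-elim (none zero eq)
... | false = count-none (p ∘ suc) (none ∘ suc)

count≤1 : ∀ {n} (p : Fin n → Bool) →
          (∀ a b → a ≢ b → p a ≡ true → p b ≡ true → ⊥) → count p ≤ 1
count≤1 {zero}  p one = z≤n
count≤1 {suc n} p one with p zero in eq
... | true  = ≤-reflexive (cong suc (count-none (p ∘ suc) (λ a pa → one zero (suc a) (λ ()) eq pa)))
... | false = count≤1 (p ∘ suc) (λ a b a≢b → one (suc a) (suc b) (a≢b ∘ Fin.suc-injective))

count≤2 : ∀ {n} (p : Fin n → Bool) →
          (∀ a b c → a ≢ b → a ≢ c → b ≢ c → p a ≡ true → p b ≡ true → p c ≡ true → ⊥) →
          count p ≤ 2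
count≤2 {zero}  p two = z≤n
count≤2 {suc n} p two with p zero in eq
... | true  = s≤s (count≤1 (p ∘ suc) (λ a b a≢b → two zero (suc a) (suc b) (λ ()) (λ ()) (a≢b ∘ Fin.suc-injective) eq))
... | false = count≤2 (p ∘ suc) (λ a b c a≢b a≢c b≢c →
                two (suc a) (suc b) (suc c) (a≢b ∘ Fin.suc-injective) (a≢c ∘ Fin.suc-injective) (b≢c ∘ Fin.suc-injective))

any-intro : ∀ {n} (p : Fin n → Bool) i → p i ≡ true → any p (allFin n) ≡ true
any-intro p i pᵢ = Equivalence.to T-≡ (any⁺ p (lose (∈-allFin i) (Equivalence.from T-≡ pᵢ)))

any-elim : ∀ {n} (p : Fin n → Bool) → any p (allFin n) ≡ true → Σ (Fin n) λ i → p i ≡ true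
any-elim {n} p h with i , pᵢ ← satisfied (any⁻ p (allFin n) (Equivalence.from T-≡ h)) =
  i , Equivalence.to T-≡ pᵢ

∣tabulate∣ : ∀ {n} (p : Fin n → Bool) → ∣ Vec.tabulate p ∣ ≡ count p
∣tabulate∣ {zero}  p = refl
∣tabulate∣ {suc n} p with p zero
... | true  = cong suc (∣tabulate∣ (p ∘ suc))
... | false = ∣tabulate∣ (p ∘ suc)

sumₗ-allFin : ∀ {n} (f : Fin n → ℕ) → sumₗ (map f (allFin n)) ≡ sum f
sumₗ-allFin {zero}  f = refl
sumₗ-allFin {suc n} f = cong (f zero +_) (begin
  sumₗ (map f (tabulate suc))         ≡⟨ cong sumₗ (map-tabulate suc f) ⟩
  sumₗ (tabulate (f ∘ suc))           ≡⟨ cong sumₗ (sym (map-tabulate (λ i → i) (f ∘ suc))) ⟩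
  sumₗ (map (f ∘ suc) (allFin n))     ≡⟨ sumₗ-allFin (f ∘ suc) ⟩
  sum (f ∘ suc)                       ∎)
  where open ≡-Reasoning

before : ∀ {n} → Fin n → Fin n → Bool
before x y = toℕ x <ᵇ toℕ y

before-asym : ∀ {n} (x y : Fin n) → before x y ≡ true → before y x ≡ true → ⊥
before-asym x y x<y y<x = <-asym (<ᵇ⇒< (toℕ x) (toℕ y) (subst T (sym x<y) _))
                                 (<ᵇ⇒< (toℕ y) (toℕ x) (subst T (sym y<x) _))

upper : ∀ {n} → Adj n → ℕ
upper {n} B = ∑[ x < n ] ∑[ y < n ] ⟦ before x y ∧ B x y ⟧

pairs : ∀ {n} → Adj n → ℕ
pairs {n} B = ∑[ x < n ] ∑[ y < n ] ⟦ B x y ⟧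

pairs-∧ : ∀ {n} (p q : Fin n → Bool) → pairs (λ x y → p x ∧ q y) ≡ count p * count q
pairs-∧ {n} p q = begin
  ∑[ x < n ] ∑[ y < n ] ⟦ p x ∧ q y ⟧         ≡⟨ sum-cong-≗ (λ x → sum-cong-≗ (λ y → ⟦∧⟧ (p x) (q y))) ⟩
  ∑[ x < n ] ∑[ y < n ] (⟦ p x ⟧ * ⟦ q y ⟧)   ≡⟨ sum-cong-≗ (λ x → sym (*-distribˡ-sum ⟦ p x ⟧ (λ y → ⟦ q y ⟧))) ⟩
  ∑[ x < n ] (⟦ p x ⟧ * count q)             ≡⟨ sym (*-distribʳ-sum (count q) (λ x → ⟦ p x ⟧)) ⟩
  count p * count q                          ∎
  where open ≡-Reasoning

edgeCount≡upper : ∀ {n} (A : Adj n) → edgeCount A ≡ upper A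
edgeCount≡upper {n} A =
  trans (sumₗ-allFin {n} _) (sum-cong-≗ λ x →
    trans (sumₗ-allFin {n} _) (sum-cong-≗ λ y → if≡⟦⟧ (before x y ∧ A x y)))
  where
  if≡⟦⟧ : ∀ b → (if b then 1 else 0) ≡ ⟦ b ⟧
  if≡⟦⟧ true  = refl
  if≡⟦⟧ false = refl

upper-mono : ∀ {n} {A B : Adj n} → (∀ x y → A x y ≡ true → B x y ≡ true) → upper A ≤ upper B
upper-mono A⇒B = ∑-mono λ x → ∑-mono λ y → ⟦⟧-mono λ h →
  let x<y , Axy = ∧-true h in ∧-intro x<y (A⇒B x y Axy)

upper-halves : ∀ {n} (B : Adj n) → upper B + upper (λ x y → B y x) ≤ pairs B
upper-halves {n} B = begin
  upper B + upper (λ x y → B y x)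
    ≡⟨ cong (upper B +_) (∑-comm (λ x y → ⟦ before x y ∧ B y x ⟧)) ⟩
  upper B + ∑[ x < n ] ∑[ y < n ] ⟦ before y x ∧ B x y ⟧
    ≡⟨ sym (∑-distrib-+ (λ x → ∑[ y < n ] ⟦ before x y ∧ B x y ⟧) (λ x → ∑[ y < n ] ⟦ before y x ∧ B x y ⟧)) ⟩
  ∑[ x < n ] (∑[ y < n ] ⟦ before x y ∧ B x y ⟧ + ∑[ y < n ] ⟦ before y x ∧ B x y ⟧)
    ≡⟨ sum-cong-≗ (λ x → sym (∑-distrib-+ (λ y → ⟦ before x y ∧ B x y ⟧) (λ y → ⟦ before y x ∧ B x y ⟧))) ⟩
  ∑[ x < n ] ∑[ y < n ] (⟦ before x y ∧ B x y ⟧ + ⟦ before y x ∧ B x y ⟧)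
    ≤⟨ ∑-mono (λ x → ∑-mono (λ y → once x y (before x y) (before y x) refl refl)) ⟩
  pairs B ∎
  where
  open ≤-Reasoning
  once : ∀ x y b b' → before x y ≡ b → before y x ≡ b' → ⟦ b ∧ B x y ⟧ + ⟦ b' ∧ B x y ⟧ ≤ ⟦ B x y ⟧
  once x y true  true  x<y y<x = ⊥-elim (before-asym x y x<y y<x)
  once x y true  false _ _ = ≤-reflexive (+-identityʳ _)
  once x y false true  _ _ = ≤-refl
  once x y false false _ _ = z≤n

edgeCount-cover : ∀ {n} (A B : Adj n) → (∀ x y → A x y ≡ true → B x y ≡ true ⊎ B y x ≡ true) →
                  edgeCount A ≤ pairs B
edgeCount-cover {n} A B cover = begin
  edgeCount A                      ≡⟨ edgeCount≡upper A ⟩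
  upper A                          ≤⟨ ∑-mono (λ x → ∑-mono (λ y → ⟦⟧-split (split x y))) ⟩
  ∑[ x < n ] ∑[ y < n ] (⟦ before x y ∧ B x y ⟧ + ⟦ before x y ∧ B y x ⟧)
    ≡⟨ sum-cong-≗ (λ x → ∑-distrib-+ (λ y → ⟦ before x y ∧ B x y ⟧) (λ y → ⟦ before x y ∧ B y x ⟧)) ⟩
  ∑[ x < n ] (∑[ y < n ] ⟦ before x y ∧ B x y ⟧ + ∑[ y < n ] ⟦ before x y ∧ B y x ⟧)
    ≡⟨ ∑-distrib-+ (λ x → ∑[ y < n ] ⟦ before x y ∧ B x y ⟧) (λ x → ∑[ y < n ] ⟦ before x y ∧ B y x ⟧) ⟩
  upper B + upper (λ x y → B y x)  ≤⟨ upper-halves B ⟩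
  pairs B                          ∎
  where
  open ≤-Reasoning
  split : ∀ x y → before x y ∧ A x y ≡ true → before x y ∧ B x y ≡ true ⊎ before x y ∧ B y x ≡ true
  split x y h with x<y , Axy ← ∧-true h with cover x y Axy
  ... | inj₁ Bxy = inj₁ (∧-intro x<y Bxy)
  ... | inj₂ Byx = inj₂ (∧-intro x<y Byx)

edgeCount-double-cover : ∀ {n} (A B : Adj n) → (∀ x y → A x y ≡ true → B x y ≡ true × B y x ≡ true) →
                         2 * edgeCount A ≤ pairs B
edgeCount-double-cover A B cover = begin
  2 * edgeCount A                  ≡⟨ cong (edgeCount A +_) (+-identityʳ _) ⟩
  edgeCount A + edgeCount A        ≡⟨ cong₂ _+_ (edgeCount≡upper A) (edgeCount≡upper A) ⟩
  upper A + upper A                ≤⟨ +-mono-≤ (upper-mono (λ x y → proj₁ ∘ cover x y))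
                                               (upper-mono (λ x y → proj₂ ∘ cover x y)) ⟩
  upper B + upper (λ x y → B y x)  ≤⟨ upper-halves B ⟩
  pairs B                          ∎
  where open ≤-Reasoning

2ab≤a²+b² : ∀ a b → 2 * (a * b) ≤ a * a + b * b
2ab≤a²+b² a b with ≤-total a b
... | inj₁ a≤b with k , refl ← m≤n⇒∃[o]m+o≡n a≤b =
  subst (2 * (a * (a + k)) ≤_) (sym (square-gap a k)) (m≤m+n _ (k * k))
  where
  square-gap : ∀ a k → a * a + (a + k) * (a + k) ≡ 2 * (a * (a + k)) + k * k
  square-gap = solve-∀
... | inj₂ b≤a with k , refl ← m≤n⇒∃[o]m+o≡n b≤a =
  subst (2 * ((b + k) * b) ≤_) (sym (square-gap b k)) (m≤m+n _ (k * k))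
  where
  square-gap : ∀ b k → (b + k) * (b + k) + b * b ≡ 2 * ((b + k) * b) + k * k
  square-gap = solve-∀

cauchy-schwarz : ∀ {n} (c r : Fin n → ℕ) →
  ∑[ i < n ] (c i * r i) * ∑[ i < n ] (c i * r i) ≤ sum c * ∑[ i < n ] (c i * (r i * r i))
cauchy-schwarz {zero}  c r = z≤n
cauchy-schwarz {suc n} c r = begin
  (c₀ * r₀ + X) * (c₀ * r₀ + X)                         ≡⟨ expand c₀ r₀ X ⟩
  c₀ * r₀ * (c₀ * r₀) + c₀ * (2 * (r₀ * X)) + X * X      ≤⟨ +-mono-≤ (+-monoʳ-≤ (c₀ * r₀ * (c₀ * r₀)) (*-monoʳ-≤ c₀ cross-term))
                                                                     (cauchy-schwarz c' r') ⟩
  c₀ * r₀ * (c₀ * r₀) + c₀ * (Y + C * (r₀ * r₀)) + C * Y ≡⟨ collect c₀ r₀ C Y ⟩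
  (c₀ + C) * (c₀ * (r₀ * r₀) + Y)                        ∎
  where
  open ≤-Reasoning
  c₀ r₀ : ℕ
  c₀ = c zero
  r₀ = r zero
  c' r' : Fin n → ℕ
  c' = c ∘ suc
  r' = r ∘ suc
  X Y C : ℕ
  X = ∑[ i < n ] (c' i * r' i)
  Y = ∑[ i < n ] (c' i * (r' i * r' i))
  C = sum c'
  -- 2r₀ Σ cᵢrᵢ = Σ cᵢ(2 r₀ rᵢ) ≤ Σ cᵢ(rᵢ² + r₀²)
  cross-term : 2 * (r₀ * X) ≤ Y + C * (r₀ * r₀)
  cross-term = begin
    2 * (r₀ * X)                                  ≡⟨ cong (2 *_) (*-distribˡ-sum r₀ (λ i → c' i * r' i)) ⟩
    2 * ∑[ i < n ] (r₀ * (c' i * r' i))            ≡⟨ *-distribˡ-sum 2 (λ i → r₀ * (c' i * r' i)) ⟩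
    ∑[ i < n ] (2 * (r₀ * (c' i * r' i)))          ≡⟨ sum-cong-≗ (λ i → regroup r₀ (c' i) (r' i)) ⟩
    ∑[ i < n ] (c' i * (2 * (r₀ * r' i)))          ≤⟨ ∑-mono (λ i → *-monoʳ-≤ (c' i)
                                                         (subst (2 * (r₀ * r' i) ≤_) (+-comm (r₀ * r₀) (r' i * r' i)) (2ab≤a²+b² r₀ (r' i)))) ⟩
    ∑[ i < n ] (c' i * (r' i * r' i + r₀ * r₀))   ≡⟨ sum-cong-≗ (λ i → *-distribˡ-+ (c' i) (r' i * r' i) (r₀ * r₀)) ⟩
    ∑[ i < n ] (c' i * (r' i * r' i) + c' i * (r₀ * r₀)) ≡⟨ ∑-distrib-+ (λ i → c' i * (r' i * r' i)) (λ i → c' i * (r₀ * r₀)) ⟩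
    Y + ∑[ i < n ] (c' i * (r₀ * r₀))              ≡⟨ cong (Y +_) (sym (*-distribʳ-sum (r₀ * r₀) c')) ⟩
    Y + C * (r₀ * r₀)                              ∎
    where
    regroup : ∀ a c r → 2 * (a * (c * r)) ≡ c * (2 * (a * r))
    regroup = solve-∀
  expand : ∀ c₀ r₀ X → (c₀ * r₀ + X) * (c₀ * r₀ + X) ≡ c₀ * r₀ * (c₀ * r₀) + c₀ * (2 * (r₀ * X)) + X * X
  expand = solve-∀
  collect : ∀ c₀ r₀ C Y → c₀ * r₀ * (c₀ * r₀) + c₀ * (Y + C * (r₀ * r₀)) + C * Y ≡ (c₀ + C) * (c₀ * (r₀ * r₀) + Y)
  collect = solve-∀

^-distribʳ-* : ∀ m n k → (m * n) ^ k ≡ m ^ k * n ^ k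
^-distribʳ-* m n zero    = refl
^-distribʳ-* m n (suc k) = trans (cong (m * n *_) (^-distribʳ-* m n k)) (interchange m n (m ^ k) (n ^ k))
  where
  interchange : ∀ a b c d → a * b * (c * d) ≡ a * c * (b * d)
  interchange = solve-∀

cube : ∀ d → d ^ 3 ≡ d * (d * d)
cube d = cong (λ t → d * (d * t)) (*-identityʳ d)

<-from-squares : ∀ a b → a * a < b * b → a < b
<-from-squares a b a²<b² with a <? b
... | yes a<b = a<b
... | no  a≮b = ⊥-elim (<⇒≱ a²<b² (*-mono-≤ (≮⇒≥ a≮b) (≮⇒≥ a≮b)))

quadratic-bound : ∀ d P → 5 ≤ d → P * P ≤ d * (2 * (d * d) + 2 * P) → P * P < 4 * d ^ 3
quadratic-bound d@(suc _) P 5≤d quad with P ≤? 4 * d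
... | yes P≤4d = begin-strict
  P * P              ≤⟨ *-mono-≤ P≤4d P≤4d ⟩
  4 * d * (4 * d)    ≡⟨ regroup d ⟩
  4 * (d * d) * 4    <⟨ *-monoʳ-< (4 * (d * d)) 4<d ⟩
  4 * (d * d) * d    ≡⟨ sym (trans (cong (4 *_) (cube d)) (to-cube d)) ⟩
  4 * d ^ 3          ∎
  where
  open ≤-Reasoning
  4<d : 4 < d
  4<d = 5≤d
  regroup : ∀ d → 4 * d * (4 * d) ≡ 4 * (d * d) * 4
  regroup = solve-∀
  to-cube : ∀ d → 4 * (d * (d * d)) ≡ 4 * (d * d) * d
  to-cube = solve-∀
... | no P≰4d = +-cancelʳ-< (P * P) (P * P) (4 * d ^ 3) (begin-strict
  P * P + P * P                  ≡⟨ cong (P * P +_) (sym (+-identityʳ (P * P))) ⟩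
  2 * (P * P)                    ≤⟨ *-monoʳ-≤ 2 quad ⟩
  2 * (d * (2 * (d * d) + 2 * P)) ≡⟨ expand d P ⟩
  4 * (d * (d * d)) + 4 * d * P  ≡⟨ cong (λ t → 4 * t + 4 * d * P) (sym (cube d)) ⟩
  4 * d ^ 3 + 4 * d * P          <⟨ +-monoʳ-< (4 * d ^ 3) (*-monoˡ-< P {{>-nonZero (≤-<-trans z≤n 4d<P)}} 4d<P) ⟩
  4 * d ^ 3 + P * P              ∎)
  where
  open ≤-Reasoning
  4d<P : 4 * d < P
  4d<P = ≰⇒> P≰4d
  expand : ∀ d P → 2 * (d * (2 * (d * d) + 2 * P)) ≡ 4 * (d * (d * d)) + 4 * d * P
  expand = solve-∀

-- Small degrees: the trivial bound 2e ≤ d² already gives e⁵ < d⁹ when d ≤ 10,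
-- because 32e⁵ ≤ d¹⁰ ≤ 10d⁹.
small-degree : ∀ d e → 1 ≤ d → d ≤ 10 → 2 * e ≤ d * d → e ^ 5 < d ^ 9
small-degree d@(suc _) e _ d≤10 2e≤d² = *-cancelˡ-< 32 (e ^ 5) (d ^ 9) (begin-strict
  32 * e ^ 5       ≡⟨ sym (^-distribʳ-* 2 e 5) ⟩
  (2 * e) ^ 5      ≤⟨ ^-monoˡ-≤ 5 2e≤d² ⟩
  (d * d) ^ 5      ≡⟨ trans (^-distribʳ-* d d 5) (sym (^-distribˡ-+-* d 5 5)) ⟩
  d * d ^ 9        ≤⟨ *-monoˡ-≤ (d ^ 9) d≤10 ⟩
  10 * d ^ 9       <⟨ *-monoˡ-< (d ^ 9) (m≤m+n 11 21) ⟩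
  32 * d ^ 9       ∎)
  where open ≤-Reasoning

-- Large degrees: from e ≤ P and P² < 4d³ we get e¹⁰ < 4⁵d¹⁵ ≤ d¹⁸ once d³ ≥ 4⁵.
large-degree : ∀ d e P → 11 ≤ d → e ≤ P → P * P < 4 * d ^ 3 → e ^ 5 < d ^ 9
large-degree d e P 11≤d e≤P P²<4d³ = <-from-squares (e ^ 5) (d ^ 9) (begin-strict
  e ^ 5 * e ^ 5        ≤⟨ *-mono-≤ (^-monoˡ-≤ 5 e≤P) (^-monoˡ-≤ 5 e≤P) ⟩
  P ^ 5 * P ^ 5        ≡⟨ sym (^-distribʳ-* P P 5) ⟩
  (P * P) ^ 5          <⟨ ^-monoˡ-< 5 P²<4d³ ⟩
  (4 * d ^ 3) ^ 5      ≡⟨ ^-distribʳ-* 4 (d ^ 3) 5 ⟩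
  1024 * (d ^ 3) ^ 5   ≤⟨ *-monoˡ-≤ ((d ^ 3) ^ 5) 1024≤d³ ⟩
  (d ^ 3) ^ 6          ≡⟨ trans (^-*-assoc d 3 6) (^-distribˡ-+-* d 9 9) ⟩
  d ^ 9 * d ^ 9        ∎)
  where
  open ≤-Reasoning
  1024≤d³ : 1024 ≤ d ^ 3
  1024≤d³ = ≤-trans (m≤m+n 1024 307) (^-monoˡ-≤ 3 11≤d)

e⁵<d⁹ : ∀ d e P → 1 ≤ d → e ≤ P → P * P ≤ d * (2 * (d * d) + 2 * P) → 2 * e ≤ d * d → e ^ 5 < d ^ 9
e⁵<d⁹ d e P 1≤d e≤P quad 2e≤d² with d ≤? 10
... | yes d≤10 = small-degree d e 1≤d d≤10 2e≤d²
... | no  d≰10 = large-degree d e P 11≤d e≤P (quadratic-bound d P (≤-trans (m≤m+n 5 6) 11≤d) quad)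
  where
  11≤d : 11 ≤ d
  11≤d = ≰⇒> d≰10

∈-─ : ∀ {A : Set} {x y : A} {xs : List A} (y∈xs : y ∈ₗ xs) → x ∈ₗ xs → x ≢ y → x ∈ₗ xs ─ y∈xs
∈-─ (here refl) (here refl)  x≢y = ⊥-elim (x≢y refl)
∈-─ (here refl) (there x∈xs) _   = x∈xs
∈-─ (there _)   (here refl)  _   = here refl
∈-─ (there y∈xs) (there x∈xs) x≢y = there (∈-─ y∈xs x∈xs x≢y)

distinct-≤-length : ∀ {A : Set} {xs ys : List A} → AllPairs _≢_ ys → (∀ {z} → z ∈ₗ ys → z ∈ₗ xs) →
                    length ys ≤ length xs
distinct-≤-length [] _ = z≤n
distinct-≤-length {xs = xs} {y ∷ ys} (y≢ys ∷ distinct) ys⊆xs =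
  ≤-trans (s≤s (distinct-≤-length distinct λ z∈ys →
                 ∈-─ y∈xs (ys⊆xs (there z∈ys)) (λ z≡y → All.lookup y≢ys z∈ys (sym z≡y))))
          (≤-reflexive (sym (length-removeAt′ xs (index y∈xs))))
  where
  y∈xs : y ∈ₗ xs
  y∈xs = ys⊆xs (here refl)

verts-length : ∀ {n} (c : Comp n) → length (verts c) ≤ 3
verts-length (edgeC _ _)  = s≤s (s≤s z≤n)
verts-length (triC _ _ _) = ≤-refl

same-component : ∀ {n} {cs : List (Comp n)} → AllPairs VertexDisjoint cs →
                 ∀ {c₁ c₂ a} → c₁ ∈ₗ cs → c₂ ∈ₗ cs → a ∈ₗ verts c₁ → a ∈ₗ verts c₂ → c₁ ≡ c₂
same-component (_ ∷ _)         (here refl) (here refl) _  _  = refl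
same-component (disjoint ∷ _)  (here refl) (there c₂∈) a∈₁ a∈₂ = ⊥-elim (All.lookup disjoint c₂∈ _ a∈₁ a∈₂)
same-component (disjoint ∷ _)  (there c₁∈) (here refl) a∈₁ a∈₂ = ⊥-elim (All.lookup disjoint c₁∈ _ a∈₂ a∈₁)
same-component (_ ∷ disjoint)  (there c₁∈) (there c₂∈) a∈₁ a∈₂ = same-component disjoint c₁∈ c₂∈ a∈₁ a∈₂

module ColourClasses {n m : ℕ} (𝓗 : Hypergraph n m) (E : Fin m → Adj n)
                     (valid : ValidColouring 𝓗 E) where

  colour-sym : ∀ {i a b} → E i a b ≡ true → E i b a ≡ true
  colour-sym {i} {a} {b} = trans (proj₁ (proj₁ valid i) b a)

  colour-irrefl : ∀ {i a b} → E i a b ≡ true → a ≢ b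
  colour-irrefl {i} {a} Eaa refl with () ← trans (sym Eaa) (proj₂ (proj₁ valid i) a)

  colour-unique : ∀ {i j a b} → E i a b ≡ true → E j a b ≡ true → i ≡ j
  colour-unique {i} {j} {a} {b} Eᵢ Eⱼ with i ≟ j
  ... | yes i≡j = i≡j
  ... | no  i≢j with () ← trans (sym Eⱼ) (proj₂ (proj₂ (proj₂ (proj₂ valid))) i j a b i≢j Eᵢ)

  colour-mismatch : ∀ {i j a b} → E i a b ≡ true → E j a b ≡ false → i ≢ j
  colour-mismatch Eᵢ Eⱼ refl = true≢false Eᵢ Eⱼ

  colour-inside : ∀ {i a b} → E i a b ≡ true → a ∈ 𝓗 i × b ∈ 𝓗 i
  colour-inside {i} {a} {b} = proj₁ (proj₂ valid) i a b

  H-intro : ∀ {i a b} → E i a b ≡ true → HAdj E a b ≡ true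
  H-intro {i} {a} {b} = any-intro (λ j → E j a b) i

  H-elim : ∀ {a b} → HAdj E a b ≡ true → Σ (Fin m) λ i → E i a b ≡ true
  H-elim {a} {b} = any-elim (λ j → E j a b)

  -- Colour classes are vertex-disjoint unions of edges and triangles, so two
  -- edges of colour i at a vertex a close a triangle of colour i ...
  triangle-closure : ∀ {i a b c} → E i a b ≡ true → E i a c ≡ true → b ≢ c → E i b c ≡ true
  triangle-closure {i} {a} {b} {c} Eab Eac b≢c
    with _ , _ , disjoint , edge⇔ ← proj₁ (proj₂ (proj₂ (proj₂ valid))) i
    with C₁ , C₁∈ , a∈C₁ , b∈C₁ , _ ← Equivalence.to (edge⇔ a b) Eab
       | C₂ , C₂∈ , a∈C₂ , c∈C₂ , _ ← Equivalence.to (edge⇔ a c) Eac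
    with refl ← same-component disjoint C₁∈ C₂∈ a∈C₁ a∈C₂
    = Equivalence.from (edge⇔ b c) (C₁ , C₁∈ , b∈C₁ , c∈C₂ , b≢c)

  -- ... and a vertex has at most two edges of any one colour.
  colour-degree≤2 : ∀ {i a b c d} → E i a b ≡ true → E i a c ≡ true → E i a d ≡ true →
                    b ≢ c → b ≢ d → c ≢ d → ⊥
  colour-degree≤2 {i} {a} {b} {c} {d} Eab Eac Ead b≢c b≢d c≢d
    with _ , _ , disjoint , edge⇔ ← proj₁ (proj₂ (proj₂ (proj₂ valid))) i
    with C , C∈ , a∈C , b∈C , a≢b ← Equivalence.to (edge⇔ a b) Eab
       | C₂ , C₂∈ , a∈C₂ , c∈C₂ , a≢c ← Equivalence.to (edge⇔ a c) Eac
       | C₃ , C₃∈ , a∈C₃ , d∈C₃ , a≢d ← Equivalence.to (edge⇔ a d) Ead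
    with refl ← same-component disjoint C∈ C₂∈ a∈C a∈C₂
       | refl ← same-component disjoint C∈ C₃∈ a∈C a∈C₃
    = 1+n≰n (≤-trans (distinct-≤-length distinct four⊆C) (verts-length C))
    where
    distinct : AllPairs _≢_ (a ∷ b ∷ c ∷ d ∷ [])
    distinct = (a≢b All.∷ a≢c All.∷ a≢d All.∷ All.[]) ∷ (b≢c All.∷ b≢d All.∷ All.[]) ∷ (c≢d All.∷ All.[]) ∷ All.[] ∷ []
    four⊆C : ∀ {z} → z ∈ₗ a ∷ b ∷ c ∷ d ∷ [] → z ∈ₗ verts C
    four⊆C (here refl)                         = a∈C
    four⊆C (there (here refl))                 = b∈C
    four⊆C (there (there (here refl)))         = c∈C₂
    four⊆C (there (there (there (here refl)))) = d∈C₃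

  distinct-colours : ∀ {i j a b c} → E i a b ≡ true → E j a c ≡ true → b ≢ c → HAdj E b c ≡ false → i ≢ j
  distinct-colours Eab Eac b≢c b≁c refl = true≢false (H-intro (triangle-closure Eab Eac b≢c)) b≁c

  colour-excluded : ∀ {c a b z} → E c a z ≡ true → b ≢ a → HAdj E b a ≡ false → E c b z ≡ false
  colour-excluded {c} {a} {b} {z} Eaz b≢a b≁a with E c b z in Ebz
  ... | true  = ⊥-elim (distinct-colours (colour-sym Ebz) (colour-sym Eaz) b≢a b≁a refl)
  ... | false = refl

  no-rainbow-C4 : BergeC4Free 𝓗 → ∀ {a b c d i j k l} →
    E i a b ≡ true → E j b c ≡ true → E k c d ≡ true → E l d a ≡ true → a ≢ c → b ≢ d →
    i ≢ j → i ≢ k → i ≢ l → j ≢ k → j ≢ l → k ≢ l → ⊥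
  no-rainbow-C4 free {a} {b} {c} {d} {i} {j} {k} {l} Eab Ebc Ecd Eda a≢c b≢d i≢j i≢k i≢l j≢k j≢l k≢l =
    free (a , b , c , d , i , j , k , l
         , (colour-irrefl Eab , a≢c , ≢-sym (colour-irrefl Eda) , colour-irrefl Ebc , b≢d , colour-irrefl Ecd)
         , (i≢j , i≢k , i≢l , j≢k , j≢l , k≢l)
         , colour-inside Eab , colour-inside Ebc , colour-inside Ecd , colour-inside Eda)

module AtVertex {n m : ℕ} (𝓗 : Hypergraph n m) (E : Fin m → Adj n)
                (free : BergeC4Free 𝓗) (valid : ValidColouring 𝓗 E) (v : Fin n) where

  open ColourClasses 𝓗 E valid

  N : Fin n → Bool
  N = inN₁ E v

  Target : Fin m → Fin n → Set
  Target i y = y ∈ 𝓗 i × E i v y ≡ false × N y ≡ true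

  Witness : Fin n → Fin n → Fin m → Set
  Witness x y i = E i v x ≡ true × Target i y

  witness? : Fin n → Fin n → Fin m → Bool
  witness? x y i = E i v x ∧ (Vec.lookup (𝓗 i) y ∧ (not (E i v y) ∧ N y))

  pointsTo : Fin n → Fin n → Bool
  pointsTo x y = any (witness? x y) (allFin m)

  pointsTo-intro : ∀ {x y i} → Witness x y i → pointsTo x y ≡ true
  pointsTo-intro {x} {y} {i} (Evx , y∈i , ¬Evy , Ny) =
    any-intro (witness? x y) i (∧-intro Evx (∧-intro ([]=⇒lookup y∈i) (∧-intro (not-intro ¬Evy) Ny)))

  pointsTo-elim : ∀ {x y} → pointsTo x y ≡ true → Σ (Fin m) (Witness x y)
  pointsTo-elim {x} {y} h with i , w ← any-elim (witness? x y) h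
    with Evx , w₁ ← ∧-true w
    with y∈i , w₂ ← ∧-true w₁
    with ¬Evy , Ny ← ∧-true w₂
    = i , Evx , lookup⇒[]= y (𝓗 i) y∈i , not-true ¬Evy , Ny

  pointsTo-at : ∀ {x y i} → pointsTo x y ≡ true → E i v x ≡ true → Target i y
  pointsTo-at h Evx with j , Evx' , target ← pointsTo-elim h with refl ← colour-unique Evx' Evx = target

  pointsTo-source : ∀ {x y} → pointsTo x y ≡ true → N x ≡ true
  pointsTo-source h = H-intro (proj₁ (proj₂ (pointsTo-elim h)))

  pointsTo-target : ∀ {x y} → pointsTo x y ≡ true → N y ≡ true
  pointsTo-target h = proj₂ (proj₂ (proj₂ (proj₂ (pointsTo-elim h))))

  eqᵇ-false : ∀ {x y} → eqᵇ E x y ≡ false → x ≢ y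
  eqᵇ-false {x} x≠y refl = subst T x≠y (≡⇒≡ᵇ (toℕ x) (toℕ x) refl)

  Gaux'-unfold : ∀ {x y} → Gaux' E v x y ≡ true →
    N x ≡ true × N y ≡ true × x ≢ y × HAdj E x y ≡ false ×
    Σ (Fin n) λ w → HAdj E v w ≡ false × w ≢ v × HAdj E w x ≡ true × HAdj E w y ≡ true
  Gaux'-unfold {x} {y} h
    with in-aux , not-in-G ← ∧-true h
    with Nx , h₁ ← ∧-true in-aux
    with Ny , h₂ ← ∧-true h₁
    with x≠y , ∃w ← ∧-true h₂
    with w , h₃ ← any-elim _ ∃w
    with w∈N₂ , h₄ ← ∧-true h₃
    with Hwx , Hwy ← ∧-true h₄
    with w∉N₁ , h₅ ← ∧-true w∈N₂
    with w≠v , _ ← ∧-true h₅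
    = Nx , Ny , eqᵇ-false (not-true x≠y) , x≁y , w , not-true w∉N₁ , eqᵇ-false (not-true w≠v) , Hwx , Hwy
    where
    x≁y : HAdj E x y ≡ false
    x≁y = not-true (subst (λ b → not b ≡ true) (cong₂ (λ a b → a ∧ (b ∧ HAdj E x y)) Nx Ny) not-in-G)

  -- Every edge of G'_aux is covered by a pointer in one of its two directions;
  -- otherwise the four colours around v x w y are distinct, a Berge C₄.
  Gaux'-covered : ∀ x y → Gaux' E v x y ≡ true → pointsTo x y ≡ true ⊎ pointsTo y x ≡ true
  Gaux'-covered x y h
    with Nx , Ny , x≢y , x≁y , w , v≁w , w≢v , Hwx , Hwy ← Gaux'-unfold h
    with i , Evx ← H-elim Nx | k , Evy ← H-elim Ny | g , Ewx ← H-elim Hwx | j , Ewy ← H-elim Hwy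
    with i ≟ j | g ≟ k
  ... | yes refl | _ =
    inj₁ (pointsTo-intro (Evx , proj₂ (colour-inside Ewy) , colour-excluded Ewy (≢-sym w≢v) v≁w , Ny))
  ... | no _ | yes refl =
    inj₂ (pointsTo-intro (Evy , proj₂ (colour-inside Ewx) , colour-excluded Ewx (≢-sym w≢v) v≁w , Nx))
  ... | no i≢j | no g≢k = ⊥-elim (
    no-rainbow-C4 free Evx (colour-sym Ewx) Ewy (colour-sym Evy) (≢-sym w≢v) x≢y
      (distinct-colours (colour-sym Evx) (colour-sym Ewx) (≢-sym w≢v) v≁w) i≢j
      (distinct-colours Evx Evy x≢y x≁y)
      (distinct-colours Ewx Ewy x≢y x≁y) g≢k
      (≢-sym (distinct-colours (colour-sym Evy) (colour-sym Ewy) (≢-sym w≢v) v≁w)))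

  -- Two distinct hyperedges have at most two common targets: three common
  -- targets y₁, y₂, y₃ close a Berge C₄ through v, unless vy₁, vy₂, vy₃ all
  -- have the same colour, which a colour class does not allow.
  no-three-common-targets : ∀ {i i' y₁ y₂ y₃} → i ≢ i' → y₁ ≢ y₂ → y₁ ≢ y₃ → y₂ ≢ y₃ →
    Target i y₁ → Target i y₂ → Target i y₃ → Target i' y₁ → Target i' y₂ → Target i' y₃ → ⊥
  no-three-common-targets {i} {i'} {y₁} {y₂} {y₃} i≢i' y₁≢y₂ y₁≢y₃ y₂≢y₃
    (y₁∈i , v≁ᵢy₁ , Ny₁) (y₂∈i , v≁ᵢy₂ , Ny₂) (y₃∈i , v≁ᵢy₃ , Ny₃)
    (y₁∈i' , v≁ᵢ'y₁ , _) (y₂∈i' , v≁ᵢ'y₂ , _) (y₃∈i' , v≁ᵢ'y₃ , _)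
    with k₁ , E₁ ← H-elim Ny₁ | k₂ , E₂ ← H-elim Ny₂ | k₃ , E₃ ← H-elim Ny₃
    with k₁ ≟ k₃ | k₁ ≟ k₂
  ... | no k₁≢k₃ | _ =
    free (v , y₁ , y₂ , y₃ , k₁ , i , i' , k₃
         , (colour-irrefl E₁ , colour-irrefl E₂ , colour-irrefl E₃ , y₁≢y₂ , y₁≢y₃ , y₂≢y₃)
         , (colour-mismatch E₁ v≁ᵢy₁ , colour-mismatch E₁ v≁ᵢ'y₁ , k₁≢k₃ , i≢i' , ≢-sym (colour-mismatch E₃ v≁ᵢy₃) , ≢-sym (colour-mismatch E₃ v≁ᵢ'y₃))
         , colour-inside E₁ , (y₁∈i , y₂∈i) , (y₂∈i' , y₃∈i') , swap (colour-inside E₃))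
  ... | yes refl | no k₁≢k₂ =
    free (v , y₁ , y₃ , y₂ , k₁ , i , i' , k₂
         , (colour-irrefl E₁ , colour-irrefl E₃ , colour-irrefl E₂ , y₁≢y₃ , y₁≢y₂ , ≢-sym y₂≢y₃)
         , (colour-mismatch E₁ v≁ᵢy₁ , colour-mismatch E₁ v≁ᵢ'y₁ , k₁≢k₂ , i≢i' , ≢-sym (colour-mismatch E₂ v≁ᵢy₂) , ≢-sym (colour-mismatch E₂ v≁ᵢ'y₂))
         , colour-inside E₁ , (y₁∈i , y₃∈i) , (y₃∈i' , y₂∈i') , swap (colour-inside E₂))
  ... | yes refl | yes refl = colour-degree≤2 E₁ E₂ E₃ y₁≢y₂ y₁≢y₃ y₂≢y₃

  sharesColour : Fin n → Fin n → Bool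
  sharesColour x x' = any (λ j → E j v x ∧ E j v x') (allFin m)

  common : Fin n → Fin n → Fin n → Bool
  common x x' y = pointsTo x y ∧ pointsTo x' y

  few-common-targets : ∀ x x' → sharesColour x x' ≡ false →
    ∀ y₁ y₂ y₃ → y₁ ≢ y₂ → y₁ ≢ y₃ → y₂ ≢ y₃ →
    common x x' y₁ ≡ true → common x x' y₂ ≡ true → common x x' y₃ ≡ true → ⊥
  few-common-targets x x' unshared y₁ y₂ y₃ y₁≢y₂ y₁≢y₃ y₂≢y₃ c₁ c₂ c₃
    with x→y₁ , x'→y₁ ← ∧-true c₁ | x→y₂ , x'→y₂ ← ∧-true c₂ | x→y₃ , x'→y₃ ← ∧-true c₃
    with i , Evx , _ ← pointsTo-elim x→y₁ | i' , Evx' , _ ← pointsTo-elim x'→y₁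
    = no-three-common-targets i≢i' y₁≢y₂ y₁≢y₃ y₂≢y₃
        (pointsTo-at x→y₁ Evx) (pointsTo-at x→y₂ Evx) (pointsTo-at x→y₃ Evx)
        (pointsTo-at x'→y₁ Evx') (pointsTo-at x'→y₂ Evx') (pointsTo-at x'→y₃ Evx')
    where
    i≢i' : i ≢ i'
    i≢i' refl = true≢false (any-intro _ i (∧-intro Evx Evx')) unshared

  colour-partners≤2 : ∀ x → count (sharesColour x) ≤ 2
  colour-partners≤2 x = count≤2 (sharesColour x) no-three-partners
    where
    no-three-partners : ∀ x₁ x₂ x₃ → x₁ ≢ x₂ → x₁ ≢ x₃ → x₂ ≢ x₃ →
      sharesColour x x₁ ≡ true → sharesColour x x₂ ≡ true → sharesColour x x₃ ≡ true → ⊥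
    no-three-partners x₁ x₂ x₃ x₁≢x₂ x₁≢x₃ x₂≢x₃ s₁ s₂ s₃
      with i₁ , c₁ ← any-elim (λ j → E j v x ∧ E j v x₁) s₁
         | i₂ , c₂ ← any-elim (λ j → E j v x ∧ E j v x₂) s₂
         | i₃ , c₃ ← any-elim (λ j → E j v x ∧ E j v x₃) s₃
      with Evx , Evx₁ ← ∧-true c₁ | Evx' , Evx₂ ← ∧-true c₂ | Evx'' , Evx₃ ← ∧-true c₃
      with refl ← colour-unique Evx' Evx | refl ← colour-unique Evx'' Evx
      = colour-degree≤2 Evx₁ Evx₂ Evx₃ x₁≢x₂ x₁≢x₃ x₂≢x₃

  d : ℕ
  d = count N

  outdeg indeg : Fin n → ℕ
  outdeg x = count (pointsTo x)
  indeg  y = count (λ x → pointsTo x y)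

  P : ℕ
  P = pairs pointsTo

  -- The number of triples (x, x', y) with x → y ← x'.
  Q : ℕ
  Q = ∑[ y < n ] (indeg y * indeg y)

  deg≡d : deg E v ≡ d
  deg≡d = ∣tabulate∣ N

  e≤P : edgeCount (Gaux' E v) ≤ P
  e≤P = edgeCount-cover (Gaux' E v) pointsTo Gaux'-covered

  -- G'_aux is a graph on N₁(v).
  2e≤d² : 2 * edgeCount (Gaux' E v) ≤ d * d
  2e≤d² = ≤-trans (edgeCount-double-cover (Gaux' E v) (λ x y → N x ∧ N y) within) (≤-reflexive (pairs-∧ N N))
    where
    within : ∀ x y → Gaux' E v x y ≡ true → N x ∧ N y ≡ true × N y ∧ N x ≡ true
    within x y h with Nx , Ny , _ ← Gaux'-unfold h = ∧-intro Nx Ny , ∧-intro Ny Nx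

  indeg-inside : ∀ y → ⟦ N y ⟧ * indeg y ≡ indeg y
  indeg-inside y = by-cases (N y) refl
    where
    by-cases : ∀ b → N y ≡ b → ⟦ b ⟧ * indeg y ≡ indeg y
    by-cases true  _  = *-identityˡ (indeg y)
    by-cases false Ny = sym (count-none (λ x → pointsTo x y) (λ x x→y → true≢false (pointsTo-target x→y) Ny))

  P²≤dQ : P * P ≤ d * Q
  P²≤dQ = begin
    P * P                                                  ≡⟨ cong₂ _*_ P≡ P≡ ⟩
    ∑[ y < n ] (⟦ N y ⟧ * indeg y) * ∑[ y < n ] (⟦ N y ⟧ * indeg y)
                                                           ≤⟨ cauchy-schwarz (λ y → ⟦ N y ⟧) indeg ⟩
    d * ∑[ y < n ] (⟦ N y ⟧ * (indeg y * indeg y))          ≡⟨ cong (d *_) (sum-cong-≗ λ y →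
                                                                trans (sym (*-assoc ⟦ N y ⟧ (indeg y) (indeg y)))
                                                                      (cong (_* indeg y) (indeg-inside y))) ⟩
    d * ∑[ y < n ] (indeg y * indeg y)                     ∎
    where
    open ≤-Reasoning
    P≡ : P ≡ ∑[ y < n ] (⟦ N y ⟧ * indeg y)
    P≡ = trans (∑-comm (λ x y → ⟦ pointsTo x y ⟧)) (sum-cong-≗ λ y → sym (indeg-inside y))

  common-bound : ∀ x x' → count (common x x') ≤
                          2 * (⟦ N x ⟧ * ⟦ N x' ⟧) + ⟦ sharesColour x x' ⟧ * outdeg x
  common-bound x x' with sharesColour x x' in shared
  ... | true  = begin
    count (common x x')                          ≤⟨ count-mono {p = common x x'} {pointsTo x} (λ y → proj₁ ∘ ∧-true) ⟩
    outdeg x                                     ≡⟨ sym (*-identityˡ (outdeg x)) ⟩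
    1 * outdeg x                                 ≤⟨ m≤n+m _ (2 * (⟦ N x ⟧ * ⟦ N x' ⟧)) ⟩
    2 * (⟦ N x ⟧ * ⟦ N x' ⟧) + 1 * outdeg x      ∎
    where open ≤-Reasoning
  ... | false with N x in Nx | N x' in Nx'
  ...   | true  | true  = count≤2 (common x x') (few-common-targets x x' shared)
  ...   | false | _     = ≤-reflexive (count-none (common x x') (λ y c → true≢false (pointsTo-source (proj₁ (∧-true c))) Nx))
  ...   | true  | false = ≤-reflexive (count-none (common x x') (λ y c → true≢false (pointsTo-source (proj₂ (∧-true c))) Nx'))

  row-bound : ∀ x → ∑[ x' < n ] count (common x x') ≤ 2 * (⟦ N x ⟧ * d) + 2 * outdeg x
  row-bound x = begin
    ∑[ x' < n ] count (common x x')
      ≤⟨ ∑-mono (common-bound x) ⟩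
    ∑[ x' < n ] (2 * (⟦ N x ⟧ * ⟦ N x' ⟧) + ⟦ sharesColour x x' ⟧ * outdeg x)
      ≡⟨ ∑-distrib-+ (λ x' → 2 * (⟦ N x ⟧ * ⟦ N x' ⟧)) (λ x' → ⟦ sharesColour x x' ⟧ * outdeg x) ⟩
    ∑[ x' < n ] (2 * (⟦ N x ⟧ * ⟦ N x' ⟧)) + ∑[ x' < n ] (⟦ sharesColour x x' ⟧ * outdeg x)
      ≡⟨ cong₂ _+_ (sym (trans (cong (2 *_) (*-distribˡ-sum ⟦ N x ⟧ (λ x' → ⟦ N x' ⟧)))
                               (*-distribˡ-sum 2 (λ x' → ⟦ N x ⟧ * ⟦ N x' ⟧))))
                   (sym (*-distribʳ-sum (outdeg x) (λ x' → ⟦ sharesColour x x' ⟧))) ⟩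
    2 * (⟦ N x ⟧ * d) + count (sharesColour x) * outdeg x
      ≤⟨ +-monoʳ-≤ (2 * (⟦ N x ⟧ * d)) (*-monoˡ-≤ (outdeg x) (colour-partners≤2 x)) ⟩
    2 * (⟦ N x ⟧ * d) + 2 * outdeg x ∎
    where open ≤-Reasoning

  -- Counting the triples by the pair (x, x') first.
  Q≤ : Q ≤ 2 * (d * d) + 2 * P
  Q≤ = begin
    ∑[ y < n ] (indeg y * indeg y)
      ≡⟨ sum-cong-≗ (λ y → sym (pairs-∧ (λ x → pointsTo x y) (λ x → pointsTo x y))) ⟩
    ∑[ y < n ] ∑[ x < n ] ∑[ x' < n ] ⟦ common x x' y ⟧
      ≡⟨ ∑-comm (λ y x → ∑[ x' < n ] ⟦ common x x' y ⟧) ⟩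
    ∑[ x < n ] ∑[ y < n ] ∑[ x' < n ] ⟦ common x x' y ⟧
      ≡⟨ sum-cong-≗ (λ x → ∑-comm (λ y x' → ⟦ common x x' y ⟧)) ⟩
    ∑[ x < n ] ∑[ x' < n ] count (common x x')
      ≤⟨ ∑-mono row-bound ⟩
    ∑[ x < n ] (2 * (⟦ N x ⟧ * d) + 2 * outdeg x)
      ≡⟨ ∑-distrib-+ (λ x → 2 * (⟦ N x ⟧ * d)) (λ x → 2 * outdeg x) ⟩
    ∑[ x < n ] (2 * (⟦ N x ⟧ * d)) + ∑[ x < n ] (2 * outdeg x)
      ≡⟨ cong₂ _+_ (sym (trans (cong (2 *_) (*-distribʳ-sum d (λ x → ⟦ N x ⟧)))
                               (*-distribˡ-sum 2 (λ x → ⟦ N x ⟧ * d))))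
                   (sym (*-distribˡ-sum 2 outdeg)) ⟩
    2 * (d * d) + 2 * P ∎
    where open ≤-Reasoning

lemma3 : ∀ (n m : ℕ) (𝓗 : Hypergraph n m) (E : Fin m → Adj n) →
           BergeC4Free 𝓗 → ValidColouring 𝓗 E →
           ∀ (v : Fin n) → 1 ≤ deg E v →
           edgeCount (Gaux' E v) ^ 5 < deg E v ^ 9
lemma3 n m 𝓗 E free valid v 1≤deg =
  subst (λ δ → edgeCount (Gaux' E v) ^ 5 < δ ^ 9) (sym deg≡d)
    (e⁵<d⁹ d (edgeCount (Gaux' E v)) P (subst (1 ≤_) deg≡d 1≤deg)
           e≤P (≤-trans P²≤dQ (*-monoʳ-≤ d Q≤)) 2e≤d²)
  where open AtVertex 𝓗 E free valid v
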